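{- For an integer $r$, let $\mathfrak{R}_r=(t_{n,k})_{n,k\ge0}$ be the Riordan array $\left(\frac{1}{(1-rx)\sqrt{1-4x}},\, xc(x)\right)$, where $c(x)=\frac{1-\sqrt{1-4x}}{2x}$. Then for $0\le k\le n$, $$t_{n,k}=\sum_{j=0}^{n-k} r^{\,n-j-k}\binom{k+2j}{j},$$ and $t_{n,k}=0$ for $k>n$.
   Context: A Riordan array $(g(x),f(x))$, with $g(0)\neq0$, $f(0)=0$, $f'(0)\neq0$, is the lower-triangular matrix $(t_{n,k})_{n,k\ge0}$ with $t_{n,k}=[x^n]g(x)f(x)^k$. The convention $0^0=1$ is used when $r=0$. -}

module Defs where

open import Data.Nat using (ℕ; zero; suc; _∸_)
open import Data.Integer using (ℤ; +_; _+_; _*_; _-_; -_; 0ℤ; 1ℤ)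
open import Relation.Binary.PropositionalEquality using (_≡_)

PS : Set
PS = ℕ → ℤ

coeff : ℕ → PS → ℤ
coeff n a = a n

Σ< : ℕ → (ℕ → ℤ) → ℤ
Σ< zero    f = 0ℤ
Σ< (suc n) f = Σ< n f + f n

infix 4 _≈ₚ_
_≈ₚ_ : PS → PS → Set
a ≈ₚ b = ∀ n → a n ≡ b n

infixl 7 _·ₚ_
_·ₚ_ : PS → PS → PS
(a ·ₚ b) n = Σ< (suc n) (λ i → a i * b (n ∸ i))

infixl 6 _+ₚ_ _-ₚ_
_+ₚ_ : PS → PS → PS
(a +ₚ b) n = a n + b n

_-ₚ_ : PS → PS → PS
(a -ₚ b) n = a n - b n

_⋆ₚ_ : ℤ → PS → PS
(c ⋆ₚ a) n = c * a n

constₚ : ℤ → PS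
constₚ c zero    = c
constₚ c (suc _) = 0ℤ

oneₚ : PS
oneₚ = constₚ 1ℤ

Xₚ : PS
Xₚ zero          = 0ℤ
Xₚ (suc zero)    = 1ℤ
Xₚ (suc (suc _)) = 0ℤ

_^ₚ_ : PS → ℕ → PS
a ^ₚ zero  = oneₚ
a ^ₚ suc k = a ·ₚ (a ^ₚ k)

riordan : PS → PS → ℕ → ℕ → ℤ
riordan g f n k = coeff n (g ·ₚ (f ^ₚ k))

{-# OPTIONS --safe #-}
module Submission where

-- Put L = 1 - r x and B = G L. The hypotheses say S = 1 - 2F, B S = 1, and turn
-- S² = 1 - 4x into the Catalan equation F = x + F². For w(n,k) = [x^n] B F^k the
-- Catalan equation gives w(n+1,k+1) = w(n,k) + w(n+1,k+2), and B (1 - 2F) = 1 gives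
-- w(n+1,0) = 2 w(n+1,1); with w(k,k) = 1 these are Pascal's rule and the doubling
-- of central binomial coefficients for C(k+2m,m), so w(k+m,k) = C(k+2m,m). Each
-- column of (G, F) is the column of (B, F) divided by 1 - r x, i.e. convolved with
-- the powers of r, and all columns vanish above the diagonal because F(0) = 0.

open import Defs
open import Data.Nat as ℕ using (ℕ; zero; suc; _∸_; _≤_; _<_; z≤n; s≤s)
import Data.Nat.Properties as ℕ
import Data.Nat.Tactic.RingSolver as ℕ-Solver
open import Data.Nat.Combinatorics using (_C_; nCk≡nC[n∸k]; nCk+nC[k+1]≡[n+1]C[k+1])
open import Data.Integer using (ℤ; +_; _+_; _*_; _-_; 0ℤ; 1ℤ; _^_)
open import Data.Integer.Properties
open import Data.Integer.Tactic.RingSolver using (solve-∀)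
open import Data.Product using (_×_; _,_)
open import Relation.Binary.PropositionalEquality
open import Relation.Nullary using (yes; no)
open ≡-Reasoning

-- Finite sums

Σ<-cong : ∀ n {f g : ℕ → ℤ} → (∀ i → i < n → f i ≡ g i) → Σ< n f ≡ Σ< n g
Σ<-cong zero    f≡g = refl
Σ<-cong (suc n) f≡g =
  cong₂ _+_ (Σ<-cong n (λ i i<n → f≡g i (ℕ.m<n⇒m<1+n i<n))) (f≡g n ℕ.≤-refl)

Σ<-zero : ∀ n {f : ℕ → ℤ} → (∀ i → i < n → f i ≡ 0ℤ) → Σ< n f ≡ 0ℤ
Σ<-zero zero    f≡0 = refl
Σ<-zero (suc n) f≡0 =
  cong₂ _+_ (Σ<-zero n (λ i i<n → f≡0 i (ℕ.m<n⇒m<1+n i<n))) (f≡0 n ℕ.≤-refl)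

Σ<-distrib-+ : ∀ n (f g : ℕ → ℤ) → Σ< n (λ i → f i + g i) ≡ Σ< n f + Σ< n g
Σ<-distrib-+ zero    f g = refl
Σ<-distrib-+ (suc n) f g =
  trans (cong (_+ (f n + g n)) (Σ<-distrib-+ n f g)) (interchange (Σ< n f) (Σ< n g) (f n) (g n))
  where
  interchange : ∀ a b c d → (a + b) + (c + d) ≡ (a + c) + (b + d)
  interchange = solve-∀

Σ<-distrib-minus : ∀ n (f g : ℕ → ℤ) → Σ< n (λ i → f i - g i) ≡ Σ< n f - Σ< n g
Σ<-distrib-minus zero    f g = refl
Σ<-distrib-minus (suc n) f g =
  trans (cong (_+ (f n - g n)) (Σ<-distrib-minus n f g)) (interchange (Σ< n f) (Σ< n g) (f n) (g n))
  where
  interchange : ∀ a b c d → (a - b) + (c - d) ≡ (a + c) - (b + d)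
  interchange = solve-∀

Σ<-distribˡ-* : ∀ n c (f : ℕ → ℤ) → Σ< n (λ i → c * f i) ≡ c * Σ< n f
Σ<-distribˡ-* zero    c f = sym (*-zeroʳ c)
Σ<-distribˡ-* (suc n) c f =
  trans (cong (_+ c * f n) (Σ<-distribˡ-* n c f)) (sym (*-distribˡ-+ c (Σ< n f) (f n)))

Σ<-head : ∀ n (f : ℕ → ℤ) → Σ< (suc n) f ≡ f 0 + Σ< n (λ i → f (suc i))
Σ<-head zero    f = trans (+-identityˡ (f 0)) (sym (+-identityʳ (f 0)))
Σ<-head (suc n) f = trans (cong (_+ f (suc n)) (Σ<-head n f)) (+-assoc (f 0) _ _)

Σ<-split : ∀ k m (f : ℕ → ℤ) → Σ< (k ℕ.+ m) f ≡ Σ< k f + Σ< m (λ j → f (k ℕ.+ j))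
Σ<-split zero    m f = sym (+-identityˡ (Σ< m f))
Σ<-split (suc k) m f = begin
    Σ< (suc (k ℕ.+ m)) f
  ≡⟨ Σ<-head (k ℕ.+ m) f ⟩
    f 0 + Σ< (k ℕ.+ m) (λ i → f (suc i))
  ≡⟨ cong (_+_ (f 0)) (Σ<-split k m (λ i → f (suc i))) ⟩
    f 0 + (Σ< k (λ i → f (suc i)) + Σ< m (λ j → f (suc k ℕ.+ j)))
  ≡⟨ sym (+-assoc (f 0) _ _) ⟩
    (f 0 + Σ< k (λ i → f (suc i))) + Σ< m (λ j → f (suc k ℕ.+ j))
  ≡⟨ cong (_+ Σ< m (λ j → f (suc k ℕ.+ j))) (sym (Σ<-head k f)) ⟩
    Σ< (suc k) f + Σ< m (λ j → f (suc k ℕ.+ j))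
  ∎

-- The ring of formal power series

tailₚ : PS → PS
tailₚ a i = a (suc i)

·ₚ-congˡ : ∀ a {b b′} → b ≈ₚ b′ → a ·ₚ b ≈ₚ a ·ₚ b′
·ₚ-congˡ a b≈b′ n = Σ<-cong (suc n) (λ i _ → cong (a i *_) (b≈b′ (n ∸ i)))

·ₚ-congʳ : ∀ b {a a′} → a ≈ₚ a′ → a ·ₚ b ≈ₚ a′ ·ₚ b
·ₚ-congʳ b a≈a′ n = Σ<-cong (suc n) (λ i _ → cong (_* b (n ∸ i)) (a≈a′ i))

·ₚ-suc-tailˡ : ∀ a b n → (a ·ₚ b) (suc n) ≡ a 0 * b (suc n) + (tailₚ a ·ₚ b) n
·ₚ-suc-tailˡ a b n = Σ<-head (suc n) (λ i → a i * b (suc n ∸ i))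

·ₚ-suc-tailʳ : ∀ a b n → (a ·ₚ b) (suc n) ≡ (a ·ₚ tailₚ b) n + a (suc n) * b 0
·ₚ-suc-tailʳ a b n = cong₂ _+_
  (Σ<-cong (suc n) (λ i i≤n → cong (λ j → a i * b j) (ℕ.+-∸-assoc 1 (ℕ.≤-pred i≤n))))
  (cong (λ j → a (suc n) * b j) (ℕ.n∸n≡0 n))

·ₚ-comm : ∀ a b → a ·ₚ b ≈ₚ b ·ₚ a
·ₚ-comm a b zero    = cong (_+_ 0ℤ) (*-comm (a 0) (b 0))
·ₚ-comm a b (suc n) = begin
    (a ·ₚ b) (suc n)
  ≡⟨ ·ₚ-suc-tailˡ a b n ⟩
    a 0 * b (suc n) + (tailₚ a ·ₚ b) n
  ≡⟨ cong₂ _+_ (*-comm (a 0) (b (suc n))) (·ₚ-comm (tailₚ a) b n) ⟩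
    b (suc n) * a 0 + (b ·ₚ tailₚ a) n
  ≡⟨ +-comm (b (suc n) * a 0) ((b ·ₚ tailₚ a) n) ⟩
    (b ·ₚ tailₚ a) n + b (suc n) * a 0
  ≡⟨ sym (·ₚ-suc-tailʳ b a n) ⟩
    (b ·ₚ a) (suc n)
  ∎

·ₚ-distribˡ-+ₚ : ∀ a b c → a ·ₚ (b +ₚ c) ≈ₚ a ·ₚ b +ₚ a ·ₚ c
·ₚ-distribˡ-+ₚ a b c n = trans
  (Σ<-cong (suc n) (λ i _ → *-distribˡ-+ (a i) (b (n ∸ i)) (c (n ∸ i))))
  (Σ<-distrib-+ (suc n) _ _)

·ₚ-distribʳ-+ₚ : ∀ a b c → (a +ₚ b) ·ₚ c ≈ₚ a ·ₚ c +ₚ b ·ₚ c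
·ₚ-distribʳ-+ₚ a b c n = trans
  (Σ<-cong (suc n) (λ i _ → *-distribʳ-+ (c (n ∸ i)) (a i) (b i)))
  (Σ<-distrib-+ (suc n) _ _)

⋆ₚ-·ₚ-assoc : ∀ c a b → (c ⋆ₚ a) ·ₚ b ≈ₚ c ⋆ₚ (a ·ₚ b)
⋆ₚ-·ₚ-assoc c a b n = trans
  (Σ<-cong (suc n) (λ i _ → *-assoc c (a i) (b (n ∸ i))))
  (Σ<-distribˡ-* (suc n) c _)

·ₚ-assoc : ∀ a b c → (a ·ₚ b) ·ₚ c ≈ₚ a ·ₚ (b ·ₚ c)
·ₚ-assoc a b c zero = base (a 0) (b 0) (c 0)
  where
  base : ∀ x y z → 0ℤ + (0ℤ + x * y) * z ≡ 0ℤ + x * (0ℤ + y * z)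
  base = solve-∀
·ₚ-assoc a b c (suc n) = begin
    ((a ·ₚ b) ·ₚ c) (suc n)
  ≡⟨ ·ₚ-suc-tailˡ (a ·ₚ b) c n ⟩
    (0ℤ + a 0 * b 0) * c (suc n) + (tailₚ (a ·ₚ b) ·ₚ c) n
  ≡⟨ cong (_+_ ((0ℤ + a 0 * b 0) * c (suc n))) tail[ab]·c ⟩
    (0ℤ + a 0 * b 0) * c (suc n) + (a 0 * (tailₚ b ·ₚ c) n + (tailₚ a ·ₚ (b ·ₚ c)) n)
  ≡⟨ regroup (a 0) (b 0) (c (suc n)) ((tailₚ b ·ₚ c) n) ((tailₚ a ·ₚ (b ·ₚ c)) n) ⟩
    a 0 * (b 0 * c (suc n) + (tailₚ b ·ₚ c) n) + (tailₚ a ·ₚ (b ·ₚ c)) n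
  ≡⟨ cong (λ x → a 0 * x + (tailₚ a ·ₚ (b ·ₚ c)) n) (sym (·ₚ-suc-tailˡ b c n)) ⟩
    a 0 * (b ·ₚ c) (suc n) + (tailₚ a ·ₚ (b ·ₚ c)) n
  ≡⟨ sym (·ₚ-suc-tailˡ a (b ·ₚ c) n) ⟩
    (a ·ₚ (b ·ₚ c)) (suc n)
  ∎
  where
  tail[ab]·c : (tailₚ (a ·ₚ b) ·ₚ c) n ≡ a 0 * (tailₚ b ·ₚ c) n + (tailₚ a ·ₚ (b ·ₚ c)) n
  tail[ab]·c = begin
      (tailₚ (a ·ₚ b) ·ₚ c) n
    ≡⟨ ·ₚ-congʳ c (·ₚ-suc-tailˡ a b) n ⟩
      ((a 0 ⋆ₚ tailₚ b +ₚ tailₚ a ·ₚ b) ·ₚ c) n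
    ≡⟨ ·ₚ-distribʳ-+ₚ (a 0 ⋆ₚ tailₚ b) (tailₚ a ·ₚ b) c n ⟩
      ((a 0 ⋆ₚ tailₚ b) ·ₚ c) n + ((tailₚ a ·ₚ b) ·ₚ c) n
    ≡⟨ cong₂ _+_ (⋆ₚ-·ₚ-assoc (a 0) (tailₚ b) c n) (·ₚ-assoc (tailₚ a) b c n) ⟩
      a 0 * (tailₚ b ·ₚ c) n + (tailₚ a ·ₚ (b ·ₚ c)) n
    ∎
  regroup : ∀ x y z u v → (0ℤ + x * y) * z + (x * u + v) ≡ x * (y * z + u) + v
  regroup = solve-∀

·ₚ-rightComm : ∀ a b c → (a ·ₚ b) ·ₚ c ≈ₚ (a ·ₚ c) ·ₚ b
·ₚ-rightComm a b c n = begin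
    ((a ·ₚ b) ·ₚ c) n  ≡⟨ ·ₚ-assoc a b c n ⟩
    (a ·ₚ (b ·ₚ c)) n  ≡⟨ ·ₚ-congˡ a (·ₚ-comm b c) n ⟩
    (a ·ₚ (c ·ₚ b)) n  ≡⟨ sym (·ₚ-assoc a c b n) ⟩
    ((a ·ₚ c) ·ₚ b) n  ∎

·ₚ-identityˡ : ∀ a → oneₚ ·ₚ a ≈ₚ a
·ₚ-identityˡ a n = begin
    (oneₚ ·ₚ a) n
  ≡⟨ Σ<-head n _ ⟩
    1ℤ * a n + Σ< n (λ i → 0ℤ * a (n ∸ suc i))
  ≡⟨ cong₂ _+_ (*-identityˡ (a n)) (Σ<-zero n (λ _ _ → refl)) ⟩
    a n + 0ℤ
  ≡⟨ +-identityʳ (a n) ⟩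
    a n
  ∎

·ₚ-identityʳ : ∀ a → a ·ₚ oneₚ ≈ₚ a
·ₚ-identityʳ a n = trans (·ₚ-comm a oneₚ n) (·ₚ-identityˡ a n)

·ₚ-[1-c⋆ₚb] : ∀ a c b n → (a ·ₚ (oneₚ -ₚ c ⋆ₚ b)) n ≡ a n - c * (a ·ₚ b) n
·ₚ-[1-c⋆ₚb] a c b n = begin
    Σ< (suc n) (λ i → a i * (oneₚ (n ∸ i) - c * b (n ∸ i)))
  ≡⟨ Σ<-cong (suc n) (λ i _ → expand (a i) (oneₚ (n ∸ i)) (b (n ∸ i)) c) ⟩
    Σ< (suc n) (λ i → a i * oneₚ (n ∸ i) - c * (a i * b (n ∸ i)))
  ≡⟨ Σ<-distrib-minus (suc n) _ _ ⟩
    (a ·ₚ oneₚ) n - Σ< (suc n) (λ i → c * (a i * b (n ∸ i)))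
  ≡⟨ cong₂ _-_ (·ₚ-identityʳ a n) (Σ<-distribˡ-* (suc n) c _) ⟩
    a n - c * (a ·ₚ b) n
  ∎
  where
  expand : ∀ x y z c → x * (y - c * z) ≡ x * y - c * (x * z)
  expand = solve-∀

tailₚ-Xₚ : tailₚ Xₚ ≈ₚ oneₚ
tailₚ-Xₚ zero    = refl
tailₚ-Xₚ (suc i) = refl

·ₚ-Xₚ-zero : ∀ a → (a ·ₚ Xₚ) 0 ≡ 0ℤ
·ₚ-Xₚ-zero a = trans (+-identityˡ (a 0 * 0ℤ)) (*-zeroʳ (a 0))

·ₚ-Xₚ-suc : ∀ a n → (a ·ₚ Xₚ) (suc n) ≡ a n
·ₚ-Xₚ-suc a n = begin
    (a ·ₚ Xₚ) (suc n)                   ≡⟨ ·ₚ-suc-tailʳ a Xₚ n ⟩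
    (a ·ₚ tailₚ Xₚ) n + a (suc n) * 0ℤ  ≡⟨ cong₂ _+_ (·ₚ-congˡ a tailₚ-Xₚ n) (*-zeroʳ (a (suc n))) ⟩
    (a ·ₚ oneₚ) n + 0ℤ                  ≡⟨ +-identityʳ ((a ·ₚ oneₚ) n) ⟩
    (a ·ₚ oneₚ) n                       ≡⟨ ·ₚ-identityʳ a n ⟩
    a n                                 ∎

·ₚ-Xₚ·ₚ-suc : ∀ a b n → (a ·ₚ (Xₚ ·ₚ b)) (suc n) ≡ (a ·ₚ b) n
·ₚ-Xₚ·ₚ-suc a b n = begin
    (a ·ₚ (Xₚ ·ₚ b)) (suc n)  ≡⟨ sym (·ₚ-assoc a Xₚ b (suc n)) ⟩
    ((a ·ₚ Xₚ) ·ₚ b) (suc n)  ≡⟨ ·ₚ-rightComm a Xₚ b (suc n) ⟩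
    ((a ·ₚ b) ·ₚ Xₚ) (suc n)  ≡⟨ ·ₚ-Xₚ-suc (a ·ₚ b) n ⟩
    (a ·ₚ b) n                ∎

a≈1-b⇒b≈1-a : ∀ {a b} → a ≈ₚ oneₚ -ₚ b → b ≈ₚ oneₚ -ₚ a
a≈1-b⇒b≈1-a {b = b} a≈1-b n =
  trans (involution (oneₚ n) (b n)) (cong (oneₚ n -_) (sym (a≈1-b n)))
  where
  involution : ∀ x y → y ≡ x - (x - y)
  involution = solve-∀

catalan-equation : ∀ {S F} → S ≈ₚ oneₚ -ₚ (+ 2) ⋆ₚ F → S ·ₚ S ≈ₚ oneₚ -ₚ (+ 4) ⋆ₚ Xₚ
                 → F ≈ₚ Xₚ +ₚ F ·ₚ F
catalan-equation {S} {F} S≈1-2F S²≈1-4X n =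
  *-cancelˡ-≡ (+ 4) (F n) (Xₚ n + (F ·ₚ F) n) (begin
    + 4 * F n                           ≡⟨ isolate (oneₚ n) (F n) ((F ·ₚ F) n) ⟩
    oneₚ n - E + + 4 * (F ·ₚ F) n       ≡⟨ cong (λ e → oneₚ n - e + + 4 * (F ·ₚ F) n)
                                              (trans (sym S²≡E) (S²≈1-4X n)) ⟩
    oneₚ n - (oneₚ n - + 4 * Xₚ n) + + 4 * (F ·ₚ F) n
                                        ≡⟨ collect (oneₚ n) (Xₚ n) ((F ·ₚ F) n) ⟩
    + 4 * (Xₚ n + (F ·ₚ F) n)           ∎)
  where
  E : ℤ
  E = oneₚ n - + 2 * F n - + 2 * (F n - + 2 * (F ·ₚ F) n)
  S·F≡F-2F² : (S ·ₚ F) n ≡ F n - + 2 * (F ·ₚ F) n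
  S·F≡F-2F² = begin
    (S ·ₚ F) n                            ≡⟨ ·ₚ-comm S F n ⟩
    (F ·ₚ S) n                            ≡⟨ ·ₚ-congˡ F S≈1-2F n ⟩
    (F ·ₚ (oneₚ -ₚ (+ 2) ⋆ₚ F)) n         ≡⟨ ·ₚ-[1-c⋆ₚb] F (+ 2) F n ⟩
    F n - + 2 * (F ·ₚ F) n                ∎
  S²≡E : (S ·ₚ S) n ≡ E
  S²≡E = begin
    (S ·ₚ S) n                            ≡⟨ ·ₚ-congˡ S S≈1-2F n ⟩
    (S ·ₚ (oneₚ -ₚ (+ 2) ⋆ₚ F)) n         ≡⟨ ·ₚ-[1-c⋆ₚb] S (+ 2) F n ⟩
    S n - + 2 * (S ·ₚ F) n                ≡⟨ cong₂ (λ s t → s - + 2 * t) (S≈1-2F n) S·F≡F-2F² ⟩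
    E                                     ∎
  isolate : ∀ o f q → + 4 * f ≡ o - (o - + 2 * f - + 2 * (f - + 2 * q)) + + 4 * q
  isolate = solve-∀
  collect : ∀ o x q → o - (o - + 4 * x) + + 4 * q ≡ + 4 * (x + q)
  collect = solve-∀

-- Order of vanishing at 0 and division by 1 - r x

ord≥ : ℕ → PS → Set
ord≥ p a = ∀ i → i < p → a i ≡ 0ℤ

ord≥-zero : ∀ a → ord≥ 0 a
ord≥-zero a i ()

a₀≡0⇒ord≥1 : ∀ {a} → a 0 ≡ 0ℤ → ord≥ 1 a
a₀≡0⇒ord≥1 a₀≡0 zero    _         = a₀≡0
a₀≡0⇒ord≥1 a₀≡0 (suc i) (s≤s ())

ord≥-·ₚ : ∀ {p q a b} → ord≥ p a → ord≥ q b → ord≥ (p ℕ.+ q) (a ·ₚ b)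
ord≥-·ₚ {p} {q} {a} {b} a-ord b-ord i i<p+q = Σ<-zero (suc i) term-zero
  where
  term-zero : ∀ j → j < suc i → a j * b (i ∸ j) ≡ 0ℤ
  term-zero j j<1+i with j ℕ.<? p
  ... | yes j<p = trans (cong (_* b (i ∸ j)) (a-ord j j<p)) (*-zeroˡ (b (i ∸ j)))
  ... | no  j≮p = trans (cong (a j *_) (b-ord (i ∸ j) i∸j<q)) (*-zeroʳ (a j))
    where
    i∸j<q : i ∸ j < q
    i∸j<q = ℕ.<-≤-trans (ℕ.∸-monoˡ-< i<p+q (ℕ.≤-pred j<1+i)) (ℕ.≤-trans
      (ℕ.∸-monoʳ-≤ (p ℕ.+ q) (ℕ.≮⇒≥ j≮p)) (ℕ.≤-reflexive (ℕ.m+n∸m≡n p q)))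

ord≥-^ₚ : ∀ {a} → ord≥ 1 a → ∀ k → ord≥ k (a ^ₚ k)
ord≥-^ₚ a-ord zero    = ord≥-zero oneₚ
ord≥-^ₚ a-ord (suc k) = ord≥-·ₚ a-ord (ord≥-^ₚ a-ord k)

riordan-column-ord≥ : ∀ G F → F 0 ≡ 0ℤ → ∀ k → ord≥ k (G ·ₚ F ^ₚ k)
riordan-column-ord≥ G F F₀≡0 k = ord≥-·ₚ (ord≥-zero G) (ord≥-^ₚ (a₀≡0⇒ord≥1 F₀≡0) k)

·ₚ[1-rX]-zero : ∀ r a → (a ·ₚ (oneₚ -ₚ r ⋆ₚ Xₚ)) 0 ≡ a 0
·ₚ[1-rX]-zero r a = begin
    (a ·ₚ (oneₚ -ₚ r ⋆ₚ Xₚ)) 0  ≡⟨ ·ₚ-[1-c⋆ₚb] a r Xₚ 0 ⟩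
    a 0 - r * (a ·ₚ Xₚ) 0       ≡⟨ cong (λ x → a 0 - r * x) (·ₚ-Xₚ-zero a) ⟩
    a 0 - r * 0ℤ                ≡⟨ cong (a 0 -_) (*-zeroʳ r) ⟩
    a 0 - 0ℤ                    ≡⟨ +-identityʳ (a 0) ⟩
    a 0                         ∎

·ₚ[1-rX]-suc : ∀ r a n → (a ·ₚ (oneₚ -ₚ r ⋆ₚ Xₚ)) (suc n) ≡ a (suc n) - r * a n
·ₚ[1-rX]-suc r a n =
  trans (·ₚ-[1-c⋆ₚb] a r Xₚ (suc n)) (cong (λ x → a (suc n) - r * x) (·ₚ-Xₚ-suc a n))

divide-by-1-rX : ∀ r {c d} → c ·ₚ (oneₚ -ₚ r ⋆ₚ Xₚ) ≈ₚ d
               → ∀ n → c n ≡ Σ< (suc n) (λ i → r ^ (n ∸ i) * d i)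
divide-by-1-rX r {c} {d} c[1-rX]≈d zero = begin
    c 0                         ≡⟨ sym (·ₚ[1-rX]-zero r c) ⟩
    (c ·ₚ (oneₚ -ₚ r ⋆ₚ Xₚ)) 0  ≡⟨ c[1-rX]≈d 0 ⟩
    d 0                         ≡⟨ sym (trans (+-identityˡ (1ℤ * d 0)) (*-identityˡ (d 0))) ⟩
    0ℤ + 1ℤ * d 0               ∎
divide-by-1-rX r {c} {d} c[1-rX]≈d (suc n) = begin
    c (suc n)
  ≡⟨ recurrence ⟩
    r * c n + d (suc n)
  ≡⟨ cong₂ _+_ (cong (r *_) (divide-by-1-rX r {c} {d} c[1-rX]≈d n))
               (sym (*-identityˡ (d (suc n)))) ⟩
    r * Σ< (suc n) (λ i → r ^ (n ∸ i) * d i) + 1ℤ * d (suc n)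
  ≡⟨ cong₂ _+_ (sym (Σ<-distribˡ-* (suc n) r _))
               (cong (λ e → r ^ e * d (suc n)) (sym (ℕ.n∸n≡0 n))) ⟩
    Σ< (suc n) (λ i → r * (r ^ (n ∸ i) * d i)) + r ^ (n ∸ n) * d (suc n)
  ≡⟨ cong (_+ r ^ (n ∸ n) * d (suc n)) (Σ<-cong (suc n) raise-exponent) ⟩
    Σ< (suc (suc n)) (λ i → r ^ (suc n ∸ i) * d i)
  ∎
  where
  recurrence : c (suc n) ≡ r * c n + d (suc n)
  recurrence = trans (split (c (suc n)) (c n) r)
    (cong (_+_ (r * c n)) (trans (sym (·ₚ[1-rX]-suc r c n)) (c[1-rX]≈d (suc n))))
    where
    split : ∀ x y r → x ≡ r * y + (x - r * y)
    split = solve-∀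
  raise-exponent : ∀ i → i < suc n → r * (r ^ (n ∸ i) * d i) ≡ r ^ (suc n ∸ i) * d i
  raise-exponent i i<1+n = trans (sym (*-assoc r (r ^ (n ∸ i)) (d i)))
    (cong (λ e → r ^ e * d i) (sym (ℕ.+-∸-assoc 1 (ℕ.≤-pred i<1+n))))

divide-by-1-rX-ord≥ : ∀ r {c d} k {n} → c ·ₚ (oneₚ -ₚ r ⋆ₚ Xₚ) ≈ₚ d → ord≥ k d → k ≤ n
                    → c n ≡ Σ< (suc (n ∸ k)) (λ j → r ^ (n ∸ j ∸ k) * d (k ℕ.+ j))
divide-by-1-rX-ord≥ r {c} {d} k {n} c[1-rX]≈d d-ord k≤n = begin
    c n
  ≡⟨ divide-by-1-rX r {c} {d} c[1-rX]≈d n ⟩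
    Σ< (suc n) term
  ≡⟨ cong (λ l → Σ< l term) (sym k+[1+n∸k]≡1+n) ⟩
    Σ< (k ℕ.+ suc (n ∸ k)) term
  ≡⟨ Σ<-split k (suc (n ∸ k)) term ⟩
    Σ< k term + Σ< (suc (n ∸ k)) (λ j → term (k ℕ.+ j))
  ≡⟨ cong₂ _+_ (Σ<-zero k below-k) (Σ<-cong (suc (n ∸ k)) from-k) ⟩
    0ℤ + Σ< (suc (n ∸ k)) (λ j → r ^ (n ∸ j ∸ k) * d (k ℕ.+ j))
  ≡⟨ +-identityˡ _ ⟩
    Σ< (suc (n ∸ k)) (λ j → r ^ (n ∸ j ∸ k) * d (k ℕ.+ j))
  ∎
  where
  term : ℕ → ℤ
  term i = r ^ (n ∸ i) * d i
  below-k : ∀ i → i < k → term i ≡ 0ℤ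
  below-k i i<k = trans (cong (r ^ (n ∸ i) *_) (d-ord i i<k)) (*-zeroʳ (r ^ (n ∸ i)))
  from-k : ∀ j → j < suc (n ∸ k) → term (k ℕ.+ j) ≡ r ^ (n ∸ j ∸ k) * d (k ℕ.+ j)
  from-k j _ = cong (λ e → r ^ e * d (k ℕ.+ j))
    (trans (cong (n ∸_) (ℕ.+-comm k j)) (sym (ℕ.∸-+-assoc n j k)))
  k+[1+n∸k]≡1+n : k ℕ.+ suc (n ∸ k) ≡ suc n
  k+[1+n∸k]≡1+n = trans (ℕ.+-suc k (n ∸ k)) (cong suc (ℕ.m+[n∸m]≡n k≤n))

-- The Riordan array (1/√(1-4x), x c(x))

2*[1+2m]Cm≡[2+2m]C[1+m] : ∀ m → 2 ℕ.* ((1 ℕ.+ 2 ℕ.* m) C m) ≡ (2 ℕ.* suc m) C suc m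
2*[1+2m]Cm≡[2+2m]C[1+m] m = begin
    2 ℕ.* (N C m)               ≡⟨ cong (N C m ℕ.+_) (ℕ.+-identityʳ (N C m)) ⟩
    N C m ℕ.+ N C m             ≡⟨ cong (N C m ℕ.+_) NCm≡NC[1+m] ⟩
    N C m ℕ.+ N C suc m         ≡⟨ nCk+nC[k+1]≡[n+1]C[k+1] N m ⟩
    suc N C suc m               ≡⟨ cong (_C suc m) (sym (ℕ.*-suc 2 m)) ⟩
    (2 ℕ.* suc m) C suc m       ∎
  where
  N : ℕ
  N = 1 ℕ.+ 2 ℕ.* m
  NCm≡NC[1+m] : N C m ≡ N C suc m
  NCm≡NC[1+m] = sym (trans (nCk≡nC[n∸k] (s≤s (ℕ.m≤m+n m (m ℕ.+ 0))))
    (cong (N C_) (trans (ℕ.m+n∸m≡n m (m ℕ.+ 0)) (ℕ.+-identityʳ m))))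

[k+2+2m]C[1+m]+[k+2+2m]Cm≡[k+3+2m]C[1+m] : ∀ k m
  → (k ℕ.+ 2 ℕ.* suc m) C suc m ℕ.+ (suc (suc k) ℕ.+ 2 ℕ.* m) C m
  ≡ (suc k ℕ.+ 2 ℕ.* suc m) C suc m
[k+2+2m]C[1+m]+[k+2+2m]Cm≡[k+3+2m]C[1+m] k m = begin
    N C suc m ℕ.+ (suc (suc k) ℕ.+ 2 ℕ.* m) C m
  ≡⟨ cong (λ l → N C suc m ℕ.+ l C m) (reindex k m) ⟩
    N C suc m ℕ.+ N C m
  ≡⟨ ℕ.+-comm (N C suc m) (N C m) ⟩
    N C m ℕ.+ N C suc m
  ≡⟨ nCk+nC[k+1]≡[n+1]C[k+1] N m ⟩
    suc N C suc m
  ∎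
  where
  N : ℕ
  N = k ℕ.+ 2 ℕ.* suc m
  reindex : ∀ k m → suc (suc k) ℕ.+ 2 ℕ.* m ≡ k ℕ.+ 2 ℕ.* suc m
  reindex = ℕ-Solver.solve-∀

module CatalanTriangle (B F : PS) (F₀≡0 : F 0 ≡ 0ℤ) (F≈X+F² : F ≈ₚ Xₚ +ₚ F ·ₚ F)
                       (B[1-2F]≈1 : B ·ₚ (oneₚ -ₚ (+ 2) ⋆ₚ F) ≈ₚ oneₚ) where

  -- F = x + F² with F(0) = 0 characterises F = x c(x), and then 1 - 2F = √(1-4x).

  B₀≡1 : B 0 ≡ 1ℤ
  B₀≡1 = begin
    B 0                            ≡⟨ sym (+-identityʳ (B 0)) ⟩
    B 0 - + 2 * 0ℤ                 ≡⟨ cong (λ x → B 0 - + 2 * x) (sym B·F₀≡0) ⟩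
    B 0 - + 2 * (B ·ₚ F) 0         ≡⟨ sym (·ₚ-[1-c⋆ₚb] B (+ 2) F 0) ⟩
    (B ·ₚ (oneₚ -ₚ (+ 2) ⋆ₚ F)) 0  ≡⟨ B[1-2F]≈1 0 ⟩
    1ℤ                             ∎
    where
    B·F₀≡0 : (B ·ₚ F) 0 ≡ 0ℤ
    B·F₀≡0 = ord≥-·ₚ {a = B} {b = F} (ord≥-zero B) (a₀≡0⇒ord≥1 F₀≡0) 0 (s≤s z≤n)

  riordan-suc-zero : ∀ n → riordan B F (suc n) 0 ≡ + 2 * riordan B F (suc n) 1
  riordan-suc-zero n = begin
    (B ·ₚ oneₚ) (suc n)               ≡⟨ ·ₚ-identityʳ B (suc n) ⟩
    B (suc n)                         ≡⟨ i-j≡0⇒i≡j (B (suc n)) (+ 2 * (B ·ₚ F) (suc n))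
                                           (trans (sym (·ₚ-[1-c⋆ₚb] B (+ 2) F (suc n)))
                                                  (B[1-2F]≈1 (suc n))) ⟩
    + 2 * (B ·ₚ F) (suc n)            ≡⟨ cong (+ 2 *_)
                                           (sym (·ₚ-congˡ B (·ₚ-identityʳ F) (suc n))) ⟩
    + 2 * (B ·ₚ (F ·ₚ oneₚ)) (suc n)  ∎

  ·ₚ-F·ₚ-suc : ∀ a b n → (a ·ₚ (F ·ₚ b)) (suc n) ≡ (a ·ₚ b) n + (a ·ₚ (F ·ₚ (F ·ₚ b))) (suc n)
  ·ₚ-F·ₚ-suc a b n = begin
      (a ·ₚ (F ·ₚ b)) (suc n)
    ≡⟨ ·ₚ-congˡ a (·ₚ-congʳ b F≈X+F²) (suc n) ⟩
      (a ·ₚ ((Xₚ +ₚ F ·ₚ F) ·ₚ b)) (suc n)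
    ≡⟨ ·ₚ-congˡ a (·ₚ-distribʳ-+ₚ Xₚ (F ·ₚ F) b) (suc n) ⟩
      (a ·ₚ (Xₚ ·ₚ b +ₚ (F ·ₚ F) ·ₚ b)) (suc n)
    ≡⟨ ·ₚ-distribˡ-+ₚ a (Xₚ ·ₚ b) ((F ·ₚ F) ·ₚ b) (suc n) ⟩
      (a ·ₚ (Xₚ ·ₚ b)) (suc n) + (a ·ₚ ((F ·ₚ F) ·ₚ b)) (suc n)
    ≡⟨ cong₂ _+_ (·ₚ-Xₚ·ₚ-suc a b n) (·ₚ-congˡ a (·ₚ-assoc F F b) (suc n)) ⟩
      (a ·ₚ b) n + (a ·ₚ (F ·ₚ (F ·ₚ b))) (suc n)
    ∎

  riordan-suc-suc : ∀ n k → riordan B F (suc n) (suc k)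
                          ≡ riordan B F n k + riordan B F (suc n) (suc (suc k))
  riordan-suc-suc n k = ·ₚ-F·ₚ-suc B (F ^ₚ k) n

  riordan-diagonal : ∀ k → riordan B F k k ≡ 1ℤ
  riordan-diagonal zero    = trans (·ₚ-identityʳ B 0) B₀≡1
  riordan-diagonal (suc k) = begin
      riordan B F (suc k) (suc k)
    ≡⟨ riordan-suc-suc k k ⟩
      riordan B F k k + riordan B F (suc k) (suc (suc k))
    ≡⟨ cong₂ _+_ (riordan-diagonal k) (riordan-column-ord≥ B F F₀≡0 (suc (suc k)) (suc k) ℕ.≤-refl) ⟩
      1ℤ + 0ℤ
    ∎

  riordan-formula : ∀ m k → riordan B F (k ℕ.+ m) k ≡ + ((k ℕ.+ 2 ℕ.* m) C m)
  riordan-formula zero k =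
    trans (cong (λ n → riordan B F n k) (ℕ.+-identityʳ k)) (riordan-diagonal k)
  riordan-formula (suc m) zero = begin
    riordan B F (suc m) 0                  ≡⟨ riordan-suc-zero m ⟩
    + 2 * riordan B F (suc m) 1            ≡⟨ cong (+ 2 *_) (riordan-formula m 1) ⟩
    + 2 * + ((1 ℕ.+ 2 ℕ.* m) C m)          ≡⟨ sym (pos-* 2 ((1 ℕ.+ 2 ℕ.* m) C m)) ⟩
    + (2 ℕ.* ((1 ℕ.+ 2 ℕ.* m) C m))        ≡⟨ cong +_ (2*[1+2m]Cm≡[2+2m]C[1+m] m) ⟩
    + ((2 ℕ.* suc m) C suc m)              ∎
  riordan-formula (suc m) (suc k) = begin
      riordan B F (suc (k ℕ.+ suc m)) (suc k)
    ≡⟨ riordan-suc-suc (k ℕ.+ suc m) k ⟩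
      riordan B F (k ℕ.+ suc m) k + riordan B F (suc (k ℕ.+ suc m)) (suc (suc k))
    ≡⟨ cong₂ _+_ (riordan-formula (suc m) k)
         (trans (cong (λ n → riordan B F (suc n) (suc (suc k))) (ℕ.+-suc k m))
                (riordan-formula m (suc (suc k)))) ⟩
      + ((k ℕ.+ 2 ℕ.* suc m) C suc m) + + ((suc (suc k) ℕ.+ 2 ℕ.* m) C m)
    ≡⟨ sym (pos-+ ((k ℕ.+ 2 ℕ.* suc m) C suc m) ((suc (suc k) ℕ.+ 2 ℕ.* m) C m)) ⟩
      + ((k ℕ.+ 2 ℕ.* suc m) C suc m ℕ.+ (suc (suc k) ℕ.+ 2 ℕ.* m) C m)
    ≡⟨ cong +_ ([k+2+2m]C[1+m]+[k+2+2m]Cm≡[k+3+2m]C[1+m] k m) ⟩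
      + ((suc k ℕ.+ 2 ℕ.* suc m) C suc m)
    ∎

mainTheorem3 : (r : ℤ) (S G F : PS)
    → S 0 ≡ 1ℤ
    → S ·ₚ S ≈ₚ oneₚ -ₚ ((+ 4) ⋆ₚ Xₚ)
    → G ·ₚ (oneₚ -ₚ (r ⋆ₚ Xₚ)) ·ₚ S ≈ₚ oneₚ
    → (+ 2) ⋆ₚ F ≈ₚ oneₚ -ₚ S
    → ∀ (n k : ℕ)
    → (k ≤ n → riordan G F n k
                 ≡ Σ< (suc (n ∸ k)) (λ j → (r ^ (n ∸ j ∸ k)) * (+ ((k ℕ.+ 2 ℕ.* j) C j))))
      × (n < k → riordan G F n k ≡ 0ℤ)
mainTheorem3 r S G F S₀≡1 S²≈1-4X G[1-rX]S≈1 2F≈1-S n k =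
  on-or-below-diagonal , riordan-column-ord≥ G F F₀≡0 k n
  where
  F₀≡0 : F 0 ≡ 0ℤ
  F₀≡0 = *-cancelˡ-≡ (+ 2) (F 0) 0ℤ (trans (2F≈1-S 0) (cong (1ℤ -_) S₀≡1))
  S≈1-2F : S ≈ₚ oneₚ -ₚ (+ 2) ⋆ₚ F
  S≈1-2F = a≈1-b⇒b≈1-a 2F≈1-S
  L B : PS
  L = oneₚ -ₚ r ⋆ₚ Xₚ
  B = G ·ₚ L
  B[1-2F]≈1 : B ·ₚ (oneₚ -ₚ (+ 2) ⋆ₚ F) ≈ₚ oneₚ
  B[1-2F]≈1 i = trans (·ₚ-congˡ B (λ j → sym (S≈1-2F j)) i) (G[1-rX]S≈1 i)
  open CatalanTriangle B F F₀≡0 (catalan-equation S≈1-2F S²≈1-4X) B[1-2F]≈1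
  on-or-below-diagonal : k ≤ n → riordan G F n k
    ≡ Σ< (suc (n ∸ k)) (λ j → r ^ (n ∸ j ∸ k) * + ((k ℕ.+ 2 ℕ.* j) C j))
  on-or-below-diagonal k≤n = begin
      riordan G F n k
    ≡⟨ divide-by-1-rX-ord≥ r {G ·ₚ F ^ₚ k} k (·ₚ-rightComm G (F ^ₚ k) L)
                             (riordan-column-ord≥ B F F₀≡0 k) k≤n ⟩
      Σ< (suc (n ∸ k)) (λ j → r ^ (n ∸ j ∸ k) * riordan B F (k ℕ.+ j) k)
    ≡⟨ Σ<-cong (suc (n ∸ k)) (λ j _ → cong (r ^ (n ∸ j ∸ k) *_) (riordan-formula j k)) ⟩
      Σ< (suc (n ∸ k)) (λ j → r ^ (n ∸ j ∸ k) * + ((k ℕ.+ 2 ℕ.* j) C j))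
    ∎
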